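{- Let $f$ be a non-empty-valued Plott choice function on a finite set $X$, and let $\le$ be a linear order on $X$ that respects $f$. If $d\in X$ dominates $A\subseteq X$ relative to $f$, then $d$ dominates $A$ relative to $\le$.
   Context: A choice function $f$ on $X$ satisfies $f(A)\subseteq A$; Plott means $f(A\cup B)=f(f(A)\cup B)$ for all $A,B\subseteq X$; non-empty-valued means $f(A)\neq\emptyset$ for nonempty $A$. A linear order $\le$ respects $f$ if for every nonempty $A\subseteq X$ the $\le$-largest element of $A$ belongs to $f(A)$. An element $d$ dominates $A$ relative to a choice function $g$ if $A=\emptyset$ or there is $a\in A$ with $a\notin g(\{a,d\})$; relative to the linear order $\le$ this uses the choice function selecting the $\le$-maximum, i.e. $A=\emptyset$ or some $a\in A$ has $a<d$. -}

module Defs where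

open import Data.Nat using (ℕ)
open import Data.Fin using (Fin)
open import Data.Fin.Subset using (Subset; _∈_; _∉_; _⊆_; _∪_; ⁅_⁆; Empty; Nonempty)
open import Data.Product using (Σ; ∃; _×_)
open import Data.Sum using (_⊎_)
open import Relation.Binary.PropositionalEquality using (_≡_)
open import Relation.Binary.Structures using (IsTotalOrder)
open import Relation.Nullary using (¬_)
open import Level using (0ℓ)

-- The finite set X is Fin n; subsets of X are Subset n.
ChoiceFunction : ℕ → Set
ChoiceFunction n = Subset n → Subset n

IsChoiceFunction : ∀ {n} → ChoiceFunction n → Set
IsChoiceFunction {n} f = ∀ (A : Subset n) → f A ⊆ A

Plott : ∀ {n} → ChoiceFunction n → Set
Plott {n} f = ∀ (A B : Subset n) → f (A ∪ B) ≡ f (f A ∪ B)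

NonEmptyValued : ∀ {n} → ChoiceFunction n → Set
NonEmptyValued {n} f = ∀ (A : Subset n) → Nonempty A → Nonempty (f A)

IsLargest : ∀ {n} → (Fin n → Fin n → Set) → Subset n → Fin n → Set
IsLargest _≤_ A a = a ∈ A × (∀ b → b ∈ A → b ≤ a)

Respects : ∀ {n} → (Fin n → Fin n → Set) → ChoiceFunction n → Set
Respects {n} _≤_ f = ∀ (A : Subset n) → Nonempty A → ∀ a → IsLargest _≤_ A a → a ∈ f A

DominatesCF : ∀ {n} → ChoiceFunction n → Fin n → Subset n → Set
DominatesCF g d A = Empty A ⊎ ∃ λ a → a ∈ A × a ∉ g (⁅ a ⁆ ∪ ⁅ d ⁆)

DominatesOrd : ∀ {n} → (Fin n → Fin n → Set) → Fin n → Subset n → Set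
DominatesOrd _≤_ d A = Empty A ⊎ ∃ λ a → a ∈ A × (a ≤ d × ¬ (a ≡ d))

{-# OPTIONS --safe #-}
module Submission where

open import Defs
open import Data.Nat using (ℕ)
open import Data.Fin using (Fin)
open import Data.Fin.Subset using (Subset; Nonempty; _∈_; _∉_; _∪_; ⁅_⁆)
open import Data.Fin.Subset.Properties using (x∈⁅x⁆; x∈⁅y⁆⇒x≡y; x∈p∪q⁻; p⊆p∪q)
open import Data.Product using (_,_)
open import Data.Sum using (_⊎_; inj₁; inj₂; [_,_]; reduce)
open import Relation.Binary.PropositionalEquality using (_≡_; _≢_; refl; subst)
open import Relation.Binary.Structures using (IsTotalOrder)
open import Relation.Nullary using (contradiction)

-- Everything happens inside the pair {a, d}: the choice from {a} must be a, and
-- if d ≤ a then a is the largest element of {a, d}, so f must choose it.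
-- Hence a ∉ f {a, d} forces a ≠ d and a ≤ d.

module _ {n : ℕ} where

  ∈-pair⁻ : ∀ {x} (a d : Fin n) → x ∈ ⁅ a ⁆ ∪ ⁅ d ⁆ → x ≡ a ⊎ x ≡ d
  ∈-pair⁻ a d x∈ = [ (λ p → inj₁ (x∈⁅y⁆⇒x≡y a p)) , (λ p → inj₂ (x∈⁅y⁆⇒x≡y d p)) ]
                   (x∈p∪q⁻ ⁅ a ⁆ ⁅ d ⁆ x∈)

  a∈pair : (a d : Fin n) → a ∈ ⁅ a ⁆ ∪ ⁅ d ⁆
  a∈pair a d = p⊆p∪q ⁅ d ⁆ (x∈⁅x⁆ a)

  module _ {f : ChoiceFunction n} (choice : IsChoiceFunction f) (nonempty : NonEmptyValued f) where

    ∈-choice-of-⊆⁅⁆ : ∀ {A a} → Nonempty A → (∀ {x} → x ∈ A → x ≡ a) → a ∈ f A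
    ∈-choice-of-⊆⁅⁆ {A} A≢∅ A⊆⁅a⁆ with nonempty A A≢∅
    ... | b , b∈fA = subst (_∈ f A) (A⊆⁅a⁆ (choice A b∈fA)) b∈fA

    ∉-choice-of-pair⇒≢ : ∀ {a d} → a ∉ f (⁅ a ⁆ ∪ ⁅ d ⁆) → a ≢ d
    ∉-choice-of-pair⇒≢ {a} a∉ refl =
      a∉ (∈-choice-of-⊆⁅⁆ (a , a∈pair a a) (λ x∈ → reduce (∈-pair⁻ a a x∈)))

  module _ {_≤_ : Fin n → Fin n → Set} (total : IsTotalOrder _≡_ _≤_) where

    open IsTotalOrder total using (reflexive) renaming (total to ≤-total)

    largest-of-pair : ∀ {a d} → d ≤ a → IsLargest _≤_ (⁅ a ⁆ ∪ ⁅ d ⁆) a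
    largest-of-pair {a} {d} d≤a = a∈pair a d , λ b b∈ → le b (∈-pair⁻ a d b∈)
      where
      le : ∀ b → b ≡ a ⊎ b ≡ d → b ≤ a
      le b (inj₁ refl) = reflexive refl
      le b (inj₂ refl) = d≤a

    ∉-choice-of-pair⇒≤ : ∀ {f a d} → Respects _≤_ f → a ∉ f (⁅ a ⁆ ∪ ⁅ d ⁆) → a ≤ d
    ∉-choice-of-pair⇒≤ {a = a} {d} respects a∉ with ≤-total a d
    ... | inj₁ a≤d = a≤d
    ... | inj₂ d≤a = contradiction (respects _ (a , a∈pair a d) a (largest-of-pair d≤a)) a∉

lemma5p2 : ∀ {n : ℕ} (f : ChoiceFunction n) (_≤_ : Fin n → Fin n → Set) →
    IsChoiceFunction f → Plott f → NonEmptyValued f →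
    IsTotalOrder _≡_ _≤_ → Respects _≤_ f →
    ∀ (d : Fin n) (A : Subset n) → DominatesCF f d A → DominatesOrd _≤_ d A
lemma5p2 f _≤_ choice _ nonempty total respects d A (inj₁ A≡∅) = inj₁ A≡∅
lemma5p2 f _≤_ choice _ nonempty total respects d A (inj₂ (a , a∈A , a∉)) =
  inj₂ (a , a∈A , ∉-choice-of-pair⇒≤ total respects a∉ , ∉-choice-of-pair⇒≢ choice nonempty a∉)
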